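{- Let $\sigma=\mathrm{Rels}\uplus\mathrm{Cons}$ be a signature, let $\boldsymbol{\tau}^*=\bigcup_{k=0}^{\mathrm{wd}(\sigma)}\boldsymbol{\tau}^*_k$ be a satisfiability witness (for some normal-form $\mathrm{GF}$-sentence over $\sigma$), and let $n\in\mathbb{N}$ be arbitrary. Assume that for every pair of $1$-types $\tau_1,\tau_2\in\boldsymbol{\tau}^*_1$ there exists a $2$-type $\tau_{1,2}\in\boldsymbol{\tau}^*_2$ with $\mathrm{tp}^{\tau_{1,2}}[x_1]=\tau_1$ and $\mathrm{tp}^{\tau_{1,2}}[x_2]=\tau_2$. Then every structure $\mathfrak{B}$ produced by the Markovian Sampling procedure on input $(\sigma,\boldsymbol{\tau}^*,n)$ satisfies $\mathrm{tp}^{\mathfrak{B}}[a,b]\in\boldsymbol{\tau}^*_2$ for all distinct $a,b\in\{1,\dots,n\}$.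
   Context: Signatures $\sigma=\mathrm{Rels}\uplus\mathrm{Cons}$: finite, $\mathrm{Rels}$ nonempty with arities $\ge1$, $\mathrm{wd}(\sigma)$ the maximal arity. Standard name assumption: constants interpreted by themselves; domain $A=A_0\uplus\mathrm{Cons}$ with unnamed elements $A_0$. $\mathrm{GF}$: first-order formulas (with equality, no function symbols) built from atoms by Boolean connectives and guarded quantifiers $\exists\bar x(\gamma\wedge\psi)$, $\forall\bar x(\gamma\to\psi)$ ($\gamma$ an atom containing $\bar x$ and the free variables of $\psi$); normal form: finite conjunction of $\exists\bar x(\alpha(\bar x)\wedge\psi)$, $\forall\bar x(\alpha(\bar x)\to\psi)$, $\forall\bar x(\alpha(\bar x)\to\exists\bar y(\beta(\bar x,\bar y)\wedge\psi))$ with $\alpha,\beta$ atoms ($\alpha$ with variables exactly $\bar x$), $\psi$ quantifier-free with free variables among those of $\alpha$ (first two forms) or of $\beta$, where $\bar y\subseteq\mathrm{vars}(\beta)\subseteq\bar x\cup\bar y$. Types: $\mathrm{Lit}_k(\sigma)$ = atoms $R(t_1,\dots)$, $R\in\mathrm{Rels}$, $t_i\in\{x_1,\dots,x_k\}\cup\mathrm{Cons}$, and negations (no equality); $k$-type: subset with exactly one of each atom and its negation; $\boldsymbol{\tau}^\sigma_k$ = all $k$-types. Restriction $\mathrm{tp}^\tau[x_{i_1},\dots,x_{i_\ell}]$: the literals of $\tau$ with variables among those, renamed $x_{i_j}\mapsto x_j$. Interior of a $k$-type: literals whose variable set is a proper subset of $\{x_1,\dots,x_k\}$; compatible $k$-types: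 equal interiors. Guarded $k$-type: $k\le1$ or contains a positive literal with variable set exactly $\{x_1,\dots,x_k\}$. $\mathrm{tp}^{\mathfrak{A}}[a_1,\dots,a_k]$ for distinct unnamed elements: literals true under $x_i\mapsto a_i$. Closed: closed under restrictions; consistent: exactly one $0$-type. $\boldsymbol{\tau}$-guarded: every guarded realised $k$-type is in $\boldsymbol{\tau}_k$. $\boldsymbol{\tau}$-extension property: for $k<\mathrm{wd}(\sigma)$, $\tau_1\in\boldsymbol{\tau}_k$, $\tau_2\in\boldsymbol{\tau}_{k+1}$, $\tau_1\subseteq\tau_2$, every distinct unnamed $\bar a$ of type $\tau_1$ has unnamed $b\notin\bar a$ with $\mathrm{tp}[\bar a,b]=\tau_2$. A satisfiability witness for a normal-form $\varphi$: closed consistent $\boldsymbol{\tau}^*=\bigcup_{k=0}^{\mathrm{wd}(\sigma)}\boldsymbol{\tau}^*_k$ with $\emptyset\neq\boldsymbol{\tau}^*_k\subseteq\boldsymbol{\tau}^\sigma_k$, such that every $\boldsymbol{\tau}^*$-guarded $\sigma$-structure with the $\boldsymbol{\tau}^*$-extension property models $\varphi$. Markovian Sampling on $(\sigma,\boldsymbol{\tau}^*,n)$: start with the factless $\sigma$-structure $\mathfrak{B}$ on $\{1,\dots,n\}\uplus\mathrm{Cons}$; set facts on constants according to the unique $0$-type of $\boldsymbol{\tau}^*_0$; for $k=1,\dots,\mathrm{wd}(\sigma)$ and each $b_1<\dots<b_k$ in $\{1,\dots,n\}$: let $T$ be the set of $\tau\in\boldsymbol{\tau}^*_k$ compatible with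 the current $\mathrm{tp}^{\mathfrak{B}}[b_1,\dots,b_k]$; if $T\ne\emptyset$, pick $\tau\in T$ uniformly at random and modify $\mathfrak{B}$ so that $\mathrm{tp}^{\mathfrak{B}}[b_1,\dots,b_k]=\tau$; otherwise do nothing. -}

module Defs where

open import Data.Nat using (ℕ; zero; suc; _≤_; _<_; _⊔_; _+_)
open import Data.Fin using (Fin; zero; suc; inject₁; _↑ʳ_)
open import Data.Sum using (_⊎_; inj₁; inj₂)
open import Data.Product using (Σ; ∃; _×_; _,_)
open import Data.Vec using (Vec; lookup; _∷ʳ_)
import Data.Vec as V
open import Data.Vec.Relation.Unary.Any using (Any)
open import Data.List using (List)
import Data.List as L
open import Data.List.Relation.Unary.All using (All)
open import Data.Bool using (Bool; true; false)
import Data.Vec.Functional as VF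
open import Relation.Binary.PropositionalEquality using (_≡_; _≢_)
open import Relation.Nullary using (¬_)

record Signature : Set where
  field
    nRels         : ℕ
    rels-nonempty : 1 ≤ nRels
    ar            : Fin nRels → ℕ
    ar-pos        : ∀ R → 1 ≤ ar R
    nCons         : ℕ

module _ (σ : Signature) where
  open Signature σ

  wd : ℕ
  wd = L.foldr (λ R m → ar R ⊔ m) 0 (L.allFin nRels)

  Term : ℕ → Set
  Term k = Fin k ⊎ Fin nCons

  -- atoms R(t₁,…,t_ar(R)) (no equality)
  Atom : ℕ → Set
  Atom k = Σ (Fin nRels) λ R → Vec (Term k) (ar R)

  _occursIn_ : ∀ {k} → Fin k → Atom k → Set
  x occursIn (R , ts) = Any (λ t → t ≡ inj₁ x) ts

  AllVars : ∀ {k} → Atom k → Set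
  AllVars {k} α = (x : Fin k) → x occursIn α

  -- a k-type contains exactly one of each atom and its negation:
  -- we represent it by the choice function (true = positive literal)
  Type : ℕ → Set
  Type k = Atom k → Bool

  TypeSet : ℕ → Set₁
  TypeSet k = Type k → Set

  -- membership of a type in a set of types (types compared literal-wise)
  _∈ₜ_ : ∀ {k} → Type k → TypeSet k → Set
  τ ∈ₜ S = ∃ λ τ' → S τ' × (∀ α → τ' α ≡ τ α)

  renTerm : ∀ {ℓ k} → (Fin ℓ → Fin k) → Term ℓ → Term k
  renTerm ι (inj₁ i) = inj₁ (ι i)
  renTerm ι (inj₂ c) = inj₂ c

  renAtom : ∀ {ℓ k} → (Fin ℓ → Fin k) → Atom ℓ → Atom k
  renAtom ι (R , ts) = R , V.map (renTerm ι) ts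

  -- restriction tp^τ[x_{ι 0},…,x_{ι (ℓ-1)}] : literals of τ with variables
  -- among x_{ι i}, renamed x_{ι i} ↦ x_i
  restrict : ∀ {ℓ k} → (Fin ℓ → Fin k) → Type k → Type ℓ
  restrict ι τ α = τ (renAtom ι α)

  InjectiveMap : ∀ {ℓ k} → (Fin ℓ → Fin k) → Set
  InjectiveMap ι = ∀ i j → ι i ≡ ι j → i ≡ j

  -- equal interiors (literals whose variable set is a proper subset)
  Compatible : ∀ {k} → Type k → Type k → Set
  Compatible τ τ' = ∀ α → ¬ AllVars α → τ α ≡ τ' α

  Guarded : ∀ {k} → Type k → Set
  Guarded {k} τ = k ≤ 1 ⊎ ∃ λ α → AllVars α × τ α ≡ true

  SubType : ∀ {k} → Type k → Type (suc k) → Set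
  SubType τ₁ τ₂ = ∀ α → τ₂ (renAtom inject₁ α) ≡ τ₁ α

  -- τ* = ⋃_{k ≤ wd} τ*_k  (the components with k > wd are never consulted)
  TypeFamily : Set₁
  TypeFamily = (k : ℕ) → TypeSet k

  Closed : TypeFamily → Set
  Closed T = ∀ {k ℓ} → k ≤ wd → (ι : Fin ℓ → Fin k) → InjectiveMap ι →
             ∀ τ → T k τ → restrict ι τ ∈ₜ T ℓ

  Consistent : TypeFamily → Set
  Consistent T = (∃ λ τ → T 0 τ) × (∀ τ τ' → T 0 τ → T 0 τ' → ∀ α → τ α ≡ τ' α)

  -- Structures: domain A₀ ⊎ Cons, constants interpreted by themselves

  Elem : Set → Set
  Elem A₀ = A₀ ⊎ Fin nCons

  Interp : Set → Set
  Interp A₀ = (R : Fin nRels) → Vec (Elem A₀) (ar R) → Bool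

  evalTerm : ∀ {A₀ k} → Vec A₀ k → Term k → Elem A₀
  evalTerm as (inj₁ i) = inj₁ (lookup as i)
  evalTerm as (inj₂ c) = inj₂ c

  tp : ∀ {A₀ k} → Interp A₀ → Vec A₀ k → Type k
  tp I as (R , ts) = I R (V.map (evalTerm as) ts)

  Distinct : ∀ {A : Set} {k} → Vec A k → Set
  Distinct as = ∀ i j → lookup as i ≡ lookup as j → i ≡ j

  IsGuardedBy : ∀ {A₀} → TypeFamily → Interp A₀ → Set
  IsGuardedBy {A₀} T I = ∀ k (as : Vec A₀ k) → Distinct as →
                         Guarded (tp I as) → tp I as ∈ₜ T k

  ExtensionProperty : ∀ {A₀} → TypeFamily → Interp A₀ → Set
  ExtensionProperty {A₀} T I =
    ∀ k → k < wd → ∀ τ₁ τ₂ → T k τ₁ → T (suc k) τ₂ → SubType τ₁ τ₂ →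
    ∀ (as : Vec A₀ k) → Distinct as → (∀ α → tp I as α ≡ τ₁ α) →
    ∃ λ (b : A₀) → (∀ i → lookup as i ≢ b) × (∀ α → tp I (as ∷ʳ b) α ≡ τ₂ α)

  data QF (m : ℕ) : Set where
    atom  : Atom m → QF m
    equal : Term m → Term m → QF m
    neg   : QF m → QF m
    conj  : QF m → QF m → QF m
    disj  : QF m → QF m → QF m

  OccursQF : ∀ {m} → Fin m → QF m → Set
  OccursQF x (atom α)    = x occursIn α
  OccursQF x (equal s t) = s ≡ inj₁ x ⊎ t ≡ inj₁ x
  OccursQF x (neg ψ)     = OccursQF x ψ
  OccursQF x (conj ψ χ)  = OccursQF x ψ ⊎ OccursQF x χ
  OccursQF x (disj ψ χ)  = OccursQF x ψ ⊎ OccursQF x χ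

  data Conjunct : Set where
    ex-form  : (m : ℕ) (α : Atom m) → AllVars α → QF m → Conjunct
    all-form : (m : ℕ) (α : Atom m) → AllVars α → QF m → Conjunct
    all-ex-form : (m l : ℕ) (α : Atom m) → AllVars α →
                  (β : Atom (m + l)) → ((y : Fin l) → (m ↑ʳ y) occursIn β) →
                  (ψ : QF (m + l)) → ((z : Fin (m + l)) → OccursQF z ψ → z occursIn β) →
                  Conjunct

  Sentence : Set
  Sentence = List Conjunct

  evalT : ∀ {A₀ m} → (Fin m → Elem A₀) → Term m → Elem A₀
  evalT ν (inj₁ i) = ν i
  evalT ν (inj₂ c) = inj₂ c

  HoldsAtom : ∀ {A₀ m} → Interp A₀ → (Fin m → Elem A₀) → Atom m → Set
  HoldsAtom I ν (R , ts) = I R (V.map (evalT ν) ts) ≡ true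

  ⟦_⟧ : ∀ {A₀ m} → QF m → Interp A₀ → (Fin m → Elem A₀) → Set
  ⟦ atom α ⟧ I ν    = HoldsAtom I ν α
  ⟦ equal s t ⟧ I ν = evalT ν s ≡ evalT ν t
  ⟦ neg ψ ⟧ I ν     = ¬ ⟦ ψ ⟧ I ν
  ⟦ conj ψ χ ⟧ I ν  = ⟦ ψ ⟧ I ν × ⟦ χ ⟧ I ν
  ⟦ disj ψ χ ⟧ I ν  = ⟦ ψ ⟧ I ν ⊎ ⟦ χ ⟧ I ν

  SatConj : ∀ {A₀} → Interp A₀ → Conjunct → Set
  SatConj {A₀} I (ex-form m α _ ψ) =
    ∃ λ (ν : Fin m → Elem A₀) → HoldsAtom I ν α × ⟦ ψ ⟧ I ν
  SatConj {A₀} I (all-form m α _ ψ) =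
    (ν : Fin m → Elem A₀) → HoldsAtom I ν α → ⟦ ψ ⟧ I ν
  SatConj {A₀} I (all-ex-form m l α _ β _ ψ _) =
    (ν : Fin m → Elem A₀) → HoldsAtom I ν α →
    ∃ λ (μ : Fin l → Elem A₀) → HoldsAtom I (ν VF.++ μ) β × ⟦ ψ ⟧ I (ν VF.++ μ)

  Models : ∀ {A₀} → Interp A₀ → Sentence → Set
  Models I φ = All (SatConj I) φ

  record SatWitness (φ : Sentence) (T : TypeFamily) : Set₁ where
    field
      closed     : Closed T
      consistent : Consistent T
      nonempty   : ∀ k → k ≤ wd → ∃ λ τ → T k τ
      sound      : (A₀ : Set) (I : Interp A₀) →
                   IsGuardedBy T I → ExtensionProperty T I → Models I φ

  -- "modify 𝔅 so that tp[b̄] = τ": afterwards tp[b̄] = τ, and every fact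
  -- that is not the image under b̄ of an atom with variable set exactly
  -- {x₁,…,x_k} is left unchanged
  Step : ∀ {n k} → Interp (Fin n) → Vec (Fin n) k → Type k → Interp (Fin n) → Set
  Step {n} {k} I bs τ I' =
    (∀ α → tp I' bs α ≡ τ α) ×
    (∀ R (v : Vec (Elem (Fin n)) (ar R)) →
       ¬ (∃ λ (ts : Vec (Term k) (ar R)) → AllVars (R , ts) × V.map (evalTerm bs) ts ≡ v) →
       I' R v ≡ I R v)

  -- all b₁ < … < b_k in {1,…,n} (represented as Fin n), lexicographically
  incTuples : (n k : ℕ) → List (Vec (Fin n) k)
  incTuples n zero = L.[ V.[] ]
  incTuples zero (suc k) = L.[]
  incTuples (suc n) (suc k) =
    L.map (λ v → zero V.∷ V.map suc v) (incTuples n k) L.++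
    L.map (V.map suc) (incTuples n (suc k))

  -- k = 0 (the empty tuple: facts on constants), then k = 1, …, wd
  schedule : (n : ℕ) → List (Σ ℕ (Vec (Fin n)))
  schedule n = L.concatMap (λ k → L.map (k ,_) (incTuples n k)) (L.upTo (suc wd))

  data Run {n : ℕ} (T : TypeFamily) :
       List (Σ ℕ (Vec (Fin n))) → Interp (Fin n) → Interp (Fin n) → Set where
    done : ∀ {I} → Run T L.[] I I
    pick : ∀ {k bs rest I I' I''} (τ : Type k) → T k τ →
           Compatible τ (tp I bs) → Step I bs τ I' →
           Run T rest I' I'' → Run T ((k , bs) L.∷ rest) I I''
    skip : ∀ {k bs rest I I''} →
           (∀ τ → T k τ → ¬ Compatible τ (tp I bs)) →
           Run T rest I I'' → Run T ((k , bs) L.∷ rest) I I''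

  factless : ∀ {n} → Interp (Fin n)
  factless R v = false

  SampledBy : (T : TypeFamily) (n : ℕ) → Interp (Fin n) → Set
  SampledBy T n I = Run T (schedule n) factless I

-- Markovian Sampling processes tuples level by level.  A step on b̄ only
-- touches facts whose unnamed arguments are exactly the entries of b̄, so it
-- never changes the type of another increasing tuple of the same or a higher
-- level: once chosen from τ*, the 0-type, the 1-types and the 2-types of
-- increasing pairs stay in τ*.  The choice at a pair {a, b} is never skipped:
-- joinability supplies a 2-type of τ*₂ whose interior is made of the two
-- already realised 1-types (and similarly, by closedness and consistency, every
-- 1-type of τ*₁ is compatible with the realised 0-type).  If wd(σ) < 2 there
-- are no pair steps at all, but then a 2-type is all interior, so that joining
-- 2-type is itself the type of {a, b}.  Pairs with a > b follow by closedness.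

module Submission where

open import Defs
open import Data.Nat using (ℕ)
open import Data.Fin using (Fin; zero; suc)
open import Data.Vec using ([]; _∷_)
open import Data.Product using (∃; _×_)
open import Relation.Binary.PropositionalEquality using (_≡_; _≢_)

open import Data.Nat using (_≤_; _<_; _⊔_; z≤n; s≤s; z<s; _≤?_)
open import Data.Nat.Properties
  using (≤-refl; ≤-trans; <⇒≤; <-irrefl; <⇒≱; ≤-pred; ≰⇒>; m≤m⊔n; m≤n⊔m; _≟_)
open import Data.Fin using (fromℕ<; punchIn; punchOut)
import Data.Fin as Fin
open import Data.Fin.Properties
  using (punchIn-injective; punchIn-punchOut; ¬∀⟶∃¬; <-cmp; <-asym)
  renaming (_≟_ to _≟ᶠ_; <-irrefl to <ᶠ-irrefl)
open import Data.Vec using (Vec; lookup; map)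
open import Data.Vec.Properties using (map-cong; map-∘)
import Data.Vec.Properties as Vec
open import Data.Vec.Relation.Unary.Any using (Any; here; there; any?; satisfied)
import Data.Vec.Relation.Unary.Any as Any
import Data.Vec.Relation.Unary.Any.Properties as Any
import Data.Vec.Relation.Unary.All as VecAll
import Data.Vec.Relation.Unary.All.Properties as VecAll
open import Data.Vec.Relation.Unary.AllPairs as VecAllPairs using () renaming (AllPairs to VecAllPairs)
import Data.Vec.Relation.Unary.AllPairs.Properties as VecAllPairs
open import Data.Vec.Membership.Propositional using () renaming (_∈_ to _∈ᵥ_)
open import Data.Vec.Membership.Propositional.Properties using (∈-lookup)
open import Data.List using (List; upTo)
import Data.List as L
open import Data.List.Relation.Unary.All as All using (All)
import Data.List.Relation.Unary.All.Properties as All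
open import Data.List.Relation.Unary.AllPairs as AllPairs using (AllPairs)
import Data.List.Relation.Unary.AllPairs.Properties as AllPairs
import Data.List.Relation.Unary.Any as ListAny
open import Data.List.Membership.Propositional using (_∈_)
open import Data.List.Membership.Propositional.Properties using (∈-map⁺; ∈-++⁺ˡ; ∈-++⁺ʳ; ∈-allFin; ∈-concat⁺′; ∈-upTo⁺)
open import Data.Sum using (inj₁; inj₂)
import Data.Sum.Properties as Sum
open import Data.Product using (Σ; ∃₂; _,_; proj₁; proj₂)
import Data.Product.Properties as Product
open import Data.Empty using (⊥; ⊥-elim)
open import Function using (_∘_; id)
open import Relation.Nullary using (¬_; Dec; yes; no)
open import Relation.Binary using (tri<; tri≈; tri>)
open import Relation.Binary.PropositionalEquality using (refl; sym; trans; cong; cong₂; subst; _≗_; module ≡-Reasoning)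

Increasing : ∀ {n k} → Vec (Fin n) k → Set
Increasing = VecAllPairs Fin._<_

module _ (σ : Signature) where
  open Signature σ

  ar≤wd : ∀ R → ar R ≤ wd σ
  ar≤wd R = ar≤foldr (L.allFin nRels) (∈-allFin R)
    where
    ar≤foldr : ∀ {S} Rs → S ∈ Rs → ar S ≤ L.foldr (λ R m → ar R ⊔ m) 0 Rs
    ar≤foldr (S L.∷ Rs) (ListAny.here refl) = m≤m⊔n (ar S) _
    ar≤foldr (S L.∷ Rs) (ListAny.there p)   = ≤-trans (ar≤foldr Rs p) (m≤n⊔m (ar S) _)

  1≤wd : 1 ≤ wd σ
  1≤wd = ≤-trans (ar-pos R₀) (ar≤wd R₀)
    where R₀ = fromℕ< rels-nonempty

  renAtom-cong : ∀ {ℓ k} {ι ι′ : Fin ℓ → Fin k} → ι ≗ ι′ → (α : Atom σ ℓ) →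
                 renAtom σ ι α ≡ renAtom σ ι′ α
  renAtom-cong {ι = ι} {ι′} ι≗ι′ (R , ts) = cong (R ,_) (map-cong renTerm-cong ts)
    where
    renTerm-cong : ∀ t → renTerm σ ι t ≡ renTerm σ ι′ t
    renTerm-cong (inj₁ i) = cong inj₁ (ι≗ι′ i)
    renTerm-cong (inj₂ c) = refl

  tp-renAtom : ∀ {A₀ ℓ k} (I : Interp σ A₀) (ι : Fin ℓ → Fin k) (bs : Vec A₀ k) (cs : Vec A₀ ℓ) →
               (∀ i → lookup bs (ι i) ≡ lookup cs i) →
               ∀ α → tp σ I bs (renAtom σ ι α) ≡ tp σ I cs α
  tp-renAtom I ι bs cs bs∘ι≗cs (R , ts) = cong (I R) (begin
      map (evalTerm σ bs) (map (renTerm σ ι) ts)  ≡⟨ map-∘ _ _ ts ⟨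
      map (evalTerm σ bs ∘ renTerm σ ι) ts        ≡⟨ map-cong evalTerm-ren ts ⟩
      map (evalTerm σ cs) ts                      ∎)
    where
    open ≡-Reasoning
    evalTerm-ren : ∀ t → evalTerm σ bs (renTerm σ ι t) ≡ evalTerm σ cs t
    evalTerm-ren (inj₁ i) = cong inj₁ (bs∘ι≗cs i)
    evalTerm-ren (inj₂ c) = refl

  occurs? : ∀ {k} (x : Fin k) (α : Atom σ k) → Dec (_occursIn_ σ x α)
  occurs? x (R , ts) = any? (λ t → Sum.≡-dec _≟ᶠ_ _≟ᶠ_ t (inj₁ x)) ts

  strengthen : ∀ {k m} (x : Fin (ℕ.suc k)) (ts : Vec (Term σ (ℕ.suc k)) m) →
               ¬ Any (_≡ inj₁ x) ts → ∃ λ ts′ → map (renTerm σ (punchIn x)) ts′ ≡ ts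
  strengthen x []            _    = [] , refl
  strengthen x (inj₂ c ∷ ts) x∉ts =
    let ts′ , eq = strengthen x ts (x∉ts ∘ there) in inj₂ c ∷ ts′ , cong (inj₂ c ∷_) eq
  strengthen x (inj₁ y ∷ ts) x∉ts =
    let ts′ , eq = strengthen x ts (x∉ts ∘ there)
    in inj₁ (punchOut x≢y) ∷ ts′ , cong₂ _∷_ (cong inj₁ (punchIn-punchOut x≢y)) eq
    where
    x≢y : x ≢ y
    x≢y refl = x∉ts (here refl)

  interior-atom-renamed : ∀ {k} (α : Atom σ (ℕ.suc k)) → ¬ AllVars σ α →
                          ∃₂ λ x α′ → renAtom σ (punchIn x) α′ ≡ α
  interior-atom-renamed α@(R , ts) notAll =
    let x , x∉α   = ¬∀⟶∃¬ _ (λ x → _occursIn_ σ x α) (λ x → occurs? x α) notAll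
        ts′ , eq = strengthen x ts x∉α
    in x , (R , ts′) , cong (R ,_) eq

  compatible-by-facets : ∀ {k} (τ τ′ : Type σ (ℕ.suc k)) →
                         (∀ x α → τ (renAtom σ (punchIn x) α) ≡ τ′ (renAtom σ (punchIn x) α)) →
                         Compatible σ τ τ′
  compatible-by-facets τ τ′ agree α notAll with interior-atom-renamed α notAll
  ... | x , α′ , refl = agree x α′

  wd≤1⇒unguarded : wd σ ≤ 1 → (α : Atom σ 2) → ¬ AllVars σ α
  wd≤1⇒unguarded wd≤1 (R , ts) allVars =
    short-misses-a-variable ts (≤-trans (ar≤wd R) wd≤1) (allVars zero) (allVars (suc zero))
    where
    short-misses-a-variable : ∀ {m} (ts : Vec (Term σ 2) m) → m ≤ 1 →
                              Any (_≡ inj₁ zero) ts → Any (_≡ inj₁ (suc zero)) ts → ⊥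
    short-misses-a-variable (_ ∷ [])     _         (here refl) (here ())
    short-misses-a-variable (_ ∷ _ ∷ _) (s≤s ())  _           _

  ∈-evalTerms : ∀ {A₀ j m x} (as : Vec A₀ j) (us : Vec (Term σ j) m) →
                inj₁ x ∈ᵥ map (evalTerm σ as) us → x ∈ᵥ as
  ∈-evalTerms as us x∈ with satisfied (Any.map⁻ x∈)
  ... | inj₁ i , refl = ∈-lookup i as

  occurs⇒∈-evalTerms : ∀ {A₀ k m} (bs : Vec A₀ k) {i} (ws : Vec (Term σ k) m) →
                       Any (_≡ inj₁ i) ws → inj₁ (lookup bs i) ∈ᵥ map (evalTerm σ bs) ws
  occurs⇒∈-evalTerms bs ws i∈ws = Any.map⁺ (Any.map (λ { refl → refl }) i∈ws)

  step-preserves-tp : ∀ {n k j} {I I′ : Interp σ (Fin n)} {bs : Vec (Fin n) k} {τ} →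
                      Step σ I bs τ I′ → (ts : Vec (Fin n) j) →
                      ¬ (∀ i → lookup bs i ∈ᵥ ts) → ∀ α → tp σ I′ ts α ≡ tp σ I ts α
  step-preserves-tp {bs = bs} (_ , unchanged) ts bs⊈ts (R , us) =
    unchanged R (map (evalTerm σ ts) us) λ (ws , allVars , eq) → bs⊈ts λ i →
      ∈-evalTerms ts us (subst (inj₁ (lookup bs i) ∈ᵥ_) eq (occurs⇒∈-evalTerms bs ws (allVars i)))

  incTuples-increasing : ∀ n k → All Increasing (incTuples σ n k)
  incTuples-increasing n         ℕ.zero    = VecAllPairs.[] All.∷ All.[]
  incTuples-increasing ℕ.zero    (ℕ.suc k) = All.[]
  incTuples-increasing (ℕ.suc n) (ℕ.suc k) =
    All.++⁺ (All.map⁺ (All.map zero∷suc-increasing (incTuples-increasing n k)))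
            (All.map⁺ (All.map suc-increasing (incTuples-increasing n (ℕ.suc k))))
    where
    suc-increasing : ∀ {m} {v : Vec (Fin n) m} → Increasing v → Increasing (map suc v)
    suc-increasing v↑ = VecAllPairs.map⁺ (VecAllPairs.map s≤s v↑)
    zero∷suc-increasing : ∀ {m} {v : Vec (Fin n) m} → Increasing v → Increasing (zero ∷ map suc v)
    zero∷suc-increasing v↑ = VecAll.map⁺ (VecAll.universal (λ _ → z<s) _) VecAllPairs.∷ suc-increasing v↑

  [c]∈incTuples : ∀ n (c : Fin n) → c ∷ [] ∈ incTuples σ n 1
  [c]∈incTuples (ℕ.suc n) zero    =
    ∈-++⁺ˡ {ys = L.map (map suc) (incTuples σ n 1)} (∈-map⁺ (λ v → zero ∷ map suc v) (ListAny.here refl))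
  [c]∈incTuples (ℕ.suc n) (suc c) =
    ∈-++⁺ʳ _ (∈-map⁺ (map suc) ([c]∈incTuples n c))

  [a,b]∈incTuples : ∀ n {a b : Fin n} → a Fin.< b → a ∷ b ∷ [] ∈ incTuples σ n 2
  [a,b]∈incTuples (ℕ.suc n) {zero}  {suc b} _         =
    ∈-++⁺ˡ {ys = L.map (map suc) (incTuples σ n 2)} (∈-map⁺ (λ v → zero ∷ map suc v) ([c]∈incTuples n b))
  [a,b]∈incTuples (ℕ.suc n) {suc a} {suc b} (s≤s a<b) =
    ∈-++⁺ʳ _ (∈-map⁺ (map suc) ([a,b]∈incTuples n a<b))

module Schedule (σ : Signature) (n : ℕ) where

  Item : Set
  Item = Σ ℕ (Vec (Fin n))

  level : Item → ℕ
  level = proj₁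

  Sorted : List Item → Set
  Sorted = AllPairs (λ h h′ → level h ≤ level h′)

  private
    block : ℕ → List Item
    block k = L.map (k ,_) (incTuples σ n k)

    block-sorted : ∀ k → Sorted (block k)
    block-sorted k = AllPairs.map⁺ (≤-refl-pairs (incTuples σ n k))
      where
      ≤-refl-pairs : ∀ vs → AllPairs (λ _ _ → k ≤ k) vs
      ≤-refl-pairs L.[]       = AllPairs.[]
      ≤-refl-pairs (v L.∷ vs) = All.universal (λ _ → ≤-refl) vs AllPairs.∷ ≤-refl-pairs vs

    blocks-ordered : ∀ {k k′} → k ≤ k′ →
                     All (λ h → All (λ h′ → level h ≤ level h′) (block k′)) (block k)
    blocks-ordered k≤k′ =
      All.map⁺ (All.universal (λ _ → All.map⁺ (All.universal (λ _ → k≤k′) _)) _)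

    levels : List ℕ
    levels = upTo (ℕ.suc (wd σ))

  schedule-sorted : Sorted (schedule σ n)
  schedule-sorted =
    AllPairs.concat⁺
      (All.map⁺ (All.universal block-sorted levels))
      (AllPairs.map⁺ (AllPairs.applyUpTo⁺₁ id (ℕ.suc (wd σ)) (λ i<j _ → blocks-ordered (<⇒≤ i<j))))

  schedule-increasing : All (Increasing ∘ proj₂) (schedule σ n)
  schedule-increasing =
    All.concat⁺ (All.map⁺ (All.universal (λ k → All.map⁺ (incTuples-increasing σ n k)) levels))

  ∈-schedule : ∀ {k} {bs : Vec (Fin n) k} → k ≤ wd σ → bs ∈ incTuples σ n k →
               (k , bs) ∈ schedule σ n
  ∈-schedule {k} k≤wd bs∈ = ∈-concat⁺′ (∈-map⁺ (k ,_) bs∈) (∈-map⁺ block (∈-upTo⁺ (s≤s k≤wd)))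

  -- A step on h can change tp[t] only if all entries of h are entries of t;
  -- for the items below no other increasing tuple of level ≥ level t does so.
  Covered : Item → Set
  Covered (j , ts) = ∀ {k} (bs : Vec (Fin n) k) → Increasing bs → j ≤ k →
                     (∀ i → lookup bs i ∈ᵥ ts) → _≡_ {A = Item} (k , bs) (j , ts)

  []-covered : Covered (0 , [])
  []-covered []      _ _ _   = refl
  []-covered (_ ∷ _) _ _ cov with cov zero
  ... | ()

  [c]-covered : ∀ c → Covered (1 , c ∷ [])
  [c]-covered c []          _ () _
  [c]-covered c (_ ∷ [])    _ _  cov with cov zero
  ... | here refl = refl
  [c]-covered c (_ ∷ _ ∷ _) ((x<y VecAll.∷ _) VecAllPairs.∷ _) _ cov
    with cov zero | cov (suc zero)
  ... | here refl | here refl = ⊥-elim (<ᶠ-irrefl refl x<y)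

  ordered-in-pair : ∀ {a b u v : Fin n} → a Fin.< b → u Fin.< v →
                    u ∈ᵥ a ∷ b ∷ [] → v ∈ᵥ a ∷ b ∷ [] → u ≡ a × v ≡ b
  ordered-in-pair _   u<v (here refl)         (here refl)         = ⊥-elim (<ᶠ-irrefl refl u<v)
  ordered-in-pair _   _   (here refl)         (there (here refl)) = refl , refl
  ordered-in-pair a<b u<v (there (here refl)) (here refl)         = ⊥-elim (<-asym a<b u<v)
  ordered-in-pair _   u<v (there (here refl)) (there (here refl)) = ⊥-elim (<ᶠ-irrefl refl u<v)

  [a,b]-covered : ∀ {a b : Fin n} → a Fin.< b → Covered (2 , a ∷ b ∷ [])
  [a,b]-covered a<b []       _ ()       _
  [a,b]-covered a<b (_ ∷ []) _ (s≤s ()) _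
  [a,b]-covered a<b (_ ∷ _ ∷ []) ((x<y VecAll.∷ _) VecAllPairs.∷ _) _ cov
    with ordered-in-pair a<b x<y (cov zero) (cov (suc zero))
  ... | refl , refl = refl
  [a,b]-covered a<b (_ ∷ _ ∷ _ ∷ _)
                ((x<y VecAll.∷ _) VecAllPairs.∷ ((y<z VecAll.∷ _) VecAllPairs.∷ _)) _ cov
    with ordered-in-pair a<b x<y (cov zero) (cov (suc zero))
       | ordered-in-pair a<b y<z (cov (suc zero)) (cov (suc (suc zero)))
  ... | _ , refl | refl , _ = ⊥-elim (<ᶠ-irrefl refl a<b)

module Runs (σ : Signature) (T : TypeFamily σ) (n : ℕ) where
  open Schedule σ n

  Admissible : Interp σ (Fin n) → Item → Set
  Admissible I (k , bs) = _∈ₜ_ σ (tp σ I bs) (T k)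

  Ready : Interp σ (Fin n) → Item → Set
  Ready I (k , bs) = ∃ λ τ → T k τ × Compatible σ τ (tp σ I bs)

  data Settled (t : Item) (rest : List Item) (I : Interp σ (Fin n)) : Set where
    pending : t ∈ rest → Settled t rest I
    done    : All (λ h → level t ≤ level h) rest → Admissible I t → Settled t rest I

  data StepAt : Item → Interp σ (Fin n) → Interp σ (Fin n) → Set where
    picked  : ∀ {k bs I I′} (τ : Type σ k) → T k τ → Step σ I bs τ I′ → StepAt (k , bs) I I′
    skipped : ∀ {k bs I} → (∀ τ → T k τ → ¬ Compatible σ τ (tp σ I bs)) → StepAt (k , bs) I I

  run-preserves : (P : List Item → Interp σ (Fin n) → Set) →
                  (∀ {h rest I I′} → Sorted (h L.∷ rest) → Increasing (proj₂ h) →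
                   StepAt h I I′ → P (h L.∷ rest) I → P rest I′) →
                  ∀ {items I I′} → Run σ T items I I′ →
                  Sorted items → All (Increasing ∘ proj₂) items → P items I → P L.[] I′
  run-preserves P step done                 _                   _                p = p
  run-preserves P step (pick τ Tτ _ st run) s@(_ AllPairs.∷ s′) (inc All.∷ incs) p =
    run-preserves P step run s′ incs (step s inc (picked τ Tτ st) p)
  run-preserves P step (skip none run)      s@(_ AllPairs.∷ s′) (inc All.∷ incs) p =
    run-preserves P step run s′ incs (step s inc (skipped none) p)

  picked-admissible : ∀ {k bs I I′} {τ : Type σ k} → T k τ → Step σ I bs τ I′ → Admissible I′ (k , bs)
  picked-admissible Tτ (set , _) = _ , Tτ , λ α → sym (set α)

  admissible-elsewhere : ∀ {t k bs I I′} {τ : Type σ k} → Covered t → Increasing bs → level t ≤ k →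
                         (k , bs) ≢ t → Step σ I bs τ I′ → Admissible I t → Admissible I′ t
  admissible-elsewhere {j , ts} covered bs↑ j≤k h≢t st (τ′ , Tτ′ , τ′≗) =
    τ′ , Tτ′ , λ α → trans (τ′≗ α) (sym (step-preserves-tp σ st ts (h≢t ∘ covered _ bs↑ j≤k) α))

  settled-step : ∀ {t h rest I I′} → Covered t → (h ≡ t → Ready I t) →
                 Sorted (h L.∷ rest) → Increasing (proj₂ h) → StepAt h I I′ →
                 Settled t (h L.∷ rest) I → Settled t rest I′
  settled-step _ _ _ _ _ (pending (ListAny.there t∈rest)) = pending t∈rest
  settled-step _ _ (h≤rest AllPairs.∷ _) _ (picked _ Tτ st) (pending (ListAny.here refl)) =
    done h≤rest (picked-admissible Tτ st)
  settled-step _ ready _ _ (skipped none) (pending (ListAny.here refl)) =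
    let τ , Tτ , compatible = ready refl in ⊥-elim (none τ Tτ compatible)
  settled-step _ _ _ _ (skipped _) (done (_ All.∷ t≤rest) adm) = done t≤rest adm
  settled-step {t} covered _ _ bs↑ (picked {k} {bs} _ Tτ st) (done (t≤h All.∷ t≤rest) adm)
    with Product.≡-dec _≟_ (Vec.≡-dec _≟ᶠ_) (k , bs) t
  ... | yes refl = done t≤rest (picked-admissible Tτ st)
  ... | no h≢t   = done t≤rest (admissible-elsewhere covered bs↑ t≤h h≢t st adm)

  settled-below : ∀ {t h rest I} → Sorted (h L.∷ rest) → level t < level h →
                  Settled t (h L.∷ rest) I → Admissible I t
  settled-below _ t<h (pending (ListAny.here refl)) = ⊥-elim (<-irrefl refl t<h)
  settled-below (h≤rest AllPairs.∷ _) t<h (pending (ListAny.there t∈rest)) =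
    ⊥-elim (<⇒≱ t<h (All.lookup h≤rest t∈rest))
  settled-below _ _ (done _ adm) = adm

  settled-end : ∀ {t I} → Settled t L.[] I → Admissible I t
  settled-end (done _ adm) = adm

module Sampled (σ : Signature) (T : TypeFamily σ) {φ : Sentence σ} (W : SatWitness σ φ T) (n : ℕ) where
  open SatWitness W
  open Schedule σ n
  open Runs σ T n
  open ≡-Reasoning

  Joinable : Set
  Joinable = ∀ τ₁ τ₂ → T 1 τ₁ → T 1 τ₂ →
             ∃ λ τ₁₂ → T 2 τ₁₂ ×
               (∀ α → restrict σ (λ _ → zero) τ₁₂ α ≡ τ₁ α) ×
               (∀ α → restrict σ (λ _ → suc zero) τ₁₂ α ≡ τ₂ α)

  ready-empty : ∀ I → Ready I (0 , [])
  ready-empty _ = let τ , Tτ = nonempty 0 z≤n in τ , Tτ , λ _ notAll → ⊥-elim (notAll λ ())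

  ready-singleton : ∀ I {c} → Admissible I (0 , []) → Ready I (1 , c ∷ [])
  ready-singleton I {c} (τ₀ , Tτ₀ , τ₀≗) = τ₁ , Tτ₁ , compatible-by-facets σ τ₁ _ agree
    where
    τ₁ = proj₁ (nonempty 1 (1≤wd σ))
    Tτ₁ = proj₂ (nonempty 1 (1≤wd σ))
    agree : ∀ x α → τ₁ (renAtom σ (punchIn x) α) ≡ tp σ I (c ∷ []) (renAtom σ (punchIn x) α)
    agree zero α with closed (1≤wd σ) (punchIn zero) (punchIn-injective zero) τ₁ Tτ₁
    ... | τ₀′ , Tτ₀′ , τ₀′≗ = begin
      τ₁ (renAtom σ suc α)                 ≡⟨ τ₀′≗ α ⟨
      τ₀′ α                                ≡⟨ proj₂ consistent τ₀′ τ₀ Tτ₀′ Tτ₀ α ⟩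
      τ₀ α                                 ≡⟨ τ₀≗ α ⟩
      tp σ I [] α                          ≡⟨ tp-renAtom σ I suc (c ∷ []) [] (λ ()) α ⟨
      tp σ I (c ∷ []) (renAtom σ suc α)    ∎

  ready-pair : ∀ I {a b} → Joinable → Admissible I (1 , a ∷ []) → Admissible I (1 , b ∷ []) →
               Ready I (2 , a ∷ b ∷ [])
  ready-pair I {a} {b} join (τa , Tτa , τa≗) (τb , Tτb , τb≗) =
    let τ₁₂ , Tτ₁₂ , left , right = join τa τb Tτa Tτb
    in τ₁₂ , Tτ₁₂ , compatible-by-facets σ τ₁₂ _ (agree τ₁₂ left right)
    where
    agree : ∀ τ₁₂ → (∀ α → restrict σ (λ _ → zero) τ₁₂ α ≡ τa α) →
            (∀ α → restrict σ (λ _ → suc zero) τ₁₂ α ≡ τb α) →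
            ∀ x α → τ₁₂ (renAtom σ (punchIn x) α) ≡ tp σ I (a ∷ b ∷ []) (renAtom σ (punchIn x) α)
    agree τ₁₂ _ right zero α = begin
      τ₁₂ (renAtom σ suc α)                    ≡⟨ cong τ₁₂ (renAtom-cong σ (λ { zero → refl }) α) ⟩
      restrict σ (λ _ → suc zero) τ₁₂ α        ≡⟨ right α ⟩
      τb α                                     ≡⟨ τb≗ α ⟩
      tp σ I (b ∷ []) α                        ≡⟨ tp-renAtom σ I suc (a ∷ b ∷ []) (b ∷ []) (λ { zero → refl }) α ⟨
      tp σ I (a ∷ b ∷ []) (renAtom σ suc α)    ∎
    agree τ₁₂ left _ (suc zero) α = begin
      τ₁₂ (renAtom σ ι α)                      ≡⟨ cong τ₁₂ (renAtom-cong σ (λ { zero → refl }) α) ⟩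
      restrict σ (λ _ → zero) τ₁₂ α            ≡⟨ left α ⟩
      τa α                                     ≡⟨ τa≗ α ⟩
      tp σ I (a ∷ []) α                        ≡⟨ tp-renAtom σ I ι (a ∷ b ∷ []) (a ∷ []) (λ { zero → refl }) α ⟨
      tp σ I (a ∷ b ∷ []) (renAtom σ ι α)      ∎
      where ι = punchIn (suc zero)

  admissible-swap : ∀ I {a b} → 2 ≤ wd σ →
                    Admissible I (2 , b ∷ a ∷ []) → Admissible I (2 , a ∷ b ∷ [])
  admissible-swap I {a} {b} 2≤wd (τ , Tτ , τ≗) =
    let τ′ , Tτ′ , τ′≗ = closed 2≤wd swap swap-injective τ Tτ
    in τ′ , Tτ′ , λ α → trans (τ′≗ α)
         (trans (τ≗ (renAtom σ swap α)) (tp-renAtom σ I swap (b ∷ a ∷ []) (a ∷ b ∷ []) swap-lookup α))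
    where
    swap : Fin 2 → Fin 2
    swap zero       = suc zero
    swap (suc zero) = zero
    swap-injective : InjectiveMap σ swap
    swap-injective zero       zero       _ = refl
    swap-injective zero       (suc zero) ()
    swap-injective (suc zero) zero       ()
    swap-injective (suc zero) (suc zero) _ = refl
    swap-lookup : ∀ i → lookup (b ∷ a ∷ []) (swap i) ≡ lookup (a ∷ b ∷ []) i
    swap-lookup zero       = refl
    swap-lookup (suc zero) = refl

  Invariant : List Item → Interp σ (Fin n) → Set
  Invariant rest I = Settled (0 , []) rest I ×
                     (∀ c → Settled (1 , c ∷ []) rest I) ×
                     (∀ {a b} → a Fin.< b → 2 ≤ wd σ → Settled (2 , a ∷ b ∷ []) rest I)

  initial-invariant : Invariant (schedule σ n) (factless σ)
  initial-invariant =
    pending (∈-schedule z≤n (ListAny.here refl)) ,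
    (λ c → pending (∈-schedule (1≤wd σ) ([c]∈incTuples σ n c))) ,
    (λ a<b 2≤wd → pending (∈-schedule 2≤wd ([a,b]∈incTuples σ n a<b)))

  invariant-step : Joinable → ∀ {h rest I I′} → Sorted (h L.∷ rest) → Increasing (proj₂ h) →
                   StepAt h I I′ → Invariant (h L.∷ rest) I → Invariant rest I′
  invariant-step join {I = I} s h↑ st (settled₀ , settled₁ , settled₂) =
    settled-step []-covered (λ { refl → ready-empty I }) s h↑ st settled₀ ,
    (λ c → settled-step ([c]-covered c)
             (λ { refl → ready-singleton I (settled-below s z<s settled₀) })
             s h↑ st (settled₁ c)) ,
    (λ {a} {b} a<b 2≤wd → settled-step ([a,b]-covered a<b)
             (λ { refl → ready-pair I join (settled-below s (s≤s z<s) (settled₁ a))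
                                           (settled-below s (s≤s z<s) (settled₁ b)) })
             s h↑ st (settled₂ a<b 2≤wd))

  admissible-pair : ∀ {I a b} → Joinable → Invariant L.[] I → a ≢ b → Admissible I (2 , a ∷ b ∷ [])
  admissible-pair {I} {a} {b} join (_ , settled₁ , settled₂) a≢b with 2 ≤? wd σ
  ... | yes 2≤wd with <-cmp a b
  ...   | tri< a<b _ _ = settled-end (settled₂ a<b 2≤wd)
  ...   | tri≈ _ a≡b _ = ⊥-elim (a≢b a≡b)
  ...   | tri> _ _ b<a = admissible-swap I 2≤wd (settled-end (settled₂ b<a 2≤wd))
  admissible-pair {I} {a} {b} join (_ , settled₁ , _) _ | no 2≰wd =
    let τ , Tτ , compatible = ready-pair I join (settled-end (settled₁ a)) (settled-end (settled₁ b))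
    in τ , Tτ , λ α → compatible α (wd≤1⇒unguarded σ (≤-pred (≰⇒> 2≰wd)) α)

lemma32 : (σ : Signature) (T : TypeFamily σ) →
          (∃ λ φ → SatWitness σ φ T) →
          (n : ℕ) →
          (∀ τ₁ τ₂ → T 1 τ₁ → T 1 τ₂ →
            ∃ λ τ₁₂ → T 2 τ₁₂ ×
              (∀ α → restrict σ (λ _ → zero) τ₁₂ α ≡ τ₁ α) ×
              (∀ α → restrict σ (λ _ → suc zero) τ₁₂ α ≡ τ₂ α)) →
          ∀ I → SampledBy σ T n I →
          ∀ (a b : Fin n) → a ≢ b → _∈ₜ_ σ (tp σ I (a ∷ b ∷ [])) (T 2)
lemma32 σ T (_ , W) n join I run a b a≢b =
  admissible-pair join final-invariant a≢b
  where
  open Sampled σ T W n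
  open Schedule σ n
  open Runs σ T n
  final-invariant : Invariant L.[] I
  final-invariant = run-preserves Invariant (invariant-step join) run
                      schedule-sorted schedule-increasing initial-invariant
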